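{- Let $n\geq 2$, $\mathcal{B}$ a non-degenerate symmetric bilinear form on $\mathbb{F}_2^n$, and $S\subset\mathbb{F}_2^n$ a $(3,2)$-orthogonal set with respect to $\mathcal{B}$. For $\bm{v}\in S$ let $S_{\bm{v}}=\{\bm{x}\in S\setminus\{\bm{v}\}:\mathcal{B}(\bm{x},\bm{v})\neq0\}$. If $\mathcal{B}$ is the dot product, then \[ |S_{\bm{v}}|\leq\begin{cases} n, & \text{if } n\leq 7;\\ 1+2^{\frac{n-1}{2}-1}, & \text{if } n \text{ is odd and } n\geq 9;\\ 2^{\frac{n}{2}-1}, & \text{if } n \text{ is even and } n\geq 8.\end{cases} \] If $n$ is even and $\mathcal{B}=\mathcal{H}$ is the hyperbolic form, then $|S_{\bm{v}}|\leq 2^{\frac n2-1}$.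
   Context: A bilinear form $\mathcal{B}(\bm{x},\bm{y})=\bm{x}^TA\bm{y}$ is symmetric if $A$ is symmetric and non-degenerate if $\det A\neq0$. The dot product is $\bm{x}\cdot\bm{y}=\sum_i x_iy_i$. For even $n$, the hyperbolic form $\mathcal{H}$ has matrix $H\oplus\cdots\oplus H$ ($n/2$ blocks), $H=\begin{pmatrix}0&1\\1&0\end{pmatrix}$. $S\subset\mathbb{F}_2^n\setminus\{\bm{0}\}$ is $(3,2)$-orthogonal if among any three distinct elements of $S$ at least two, say $\bm{x},\bm{y}$, satisfy $\mathcal{B}(\bm{x},\bm{y})=0$. -}

module Defs where

open import Data.Bool using (Bool; true; false; _∧_; _xor_)
open import Data.Nat using (ℕ; zero; suc; _≤_; _≤?_; _/_; _%_; _∸_; _^_; _+_)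
open import Data.Fin using (Fin; toℕ)
open import Data.Vec using (Vec; foldr′; zipWith; map; tabulate; replicate)
open import Data.List using (List; filter; length)
open import Data.List.Membership.Propositional using (_∈_)
open import Data.List.Relation.Unary.All using (All)
open import Data.List.Relation.Unary.Unique.Propositional using (Unique)
open import Data.Sum using (_⊎_)
open import Data.Product using (_×_)
open import Relation.Nullary using (¬_; does)
open import Relation.Nullary.Decidable using (¬?; _×-dec_)
open import Relation.Binary.PropositionalEquality using (_≡_; _≢_)
import Data.Bool.Properties as BoolP
import Data.Vec.Properties as VecP
import Data.Nat.Properties as NatP

-- Vectors of 𝔽₂ⁿ: 𝔽₂ is modelled by Bool with _xor_ as + and _∧_ as ·.
F2^ : ℕ → Set
F2^ n = Vec Bool n

Mat : ℕ → Set
Mat n = Vec (Vec Bool n) n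

Σ₂ : ∀ {n} → Vec Bool n → Bool
Σ₂ = foldr′ _xor_ false

dot : ∀ {n} → F2^ n → F2^ n → Bool
dot x y = Σ₂ (zipWith _∧_ x y)

bilin : ∀ {n} → Mat n → F2^ n → F2^ n → Bool
bilin A x y = dot x (map (λ row → dot row y) A)

-- the matrix H ⊕ ⋯ ⊕ H (n/2 blocks, H = [[0,1],[1,0]]):
-- entry (i,j) is 1 iff i ≠ j and i, j lie in the same 2×2 block (⌊i/2⌋ = ⌊j/2⌋).
-- (only meaningful, and only used, for even n)
hypMat : (n : ℕ) → Mat n
hypMat n = tabulate λ i → tabulate λ j →
  does (¬? (toℕ i NatP.≟ toℕ j)) ∧ does ((toℕ i / 2) NatP.≟ (toℕ j / 2))

hyp : ∀ {n} → F2^ n → F2^ n → Bool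
hyp {n} = bilin (hypMat n)

_≟v_ : ∀ {n} (x y : F2^ n) → Relation.Nullary.Dec (x ≡ y)
_≟v_ = VecP.≡-dec BoolP._≟_

-- S (a finite set, given as a duplicate-free list) is (3,2)-orthogonal w.r.t. B:
-- S ⊂ 𝔽₂ⁿ ∖ {0}, and among any three distinct elements two are B-orthogonal.
ThreeTwoOrthogonal : ∀ {n} → (F2^ n → F2^ n → Bool) → List (F2^ n) → Set
ThreeTwoOrthogonal {n} B S =
  Unique S ×
  All (λ x → x ≢ replicate n false) S ×
  (∀ {x y z} → x ∈ S → y ∈ S → z ∈ S → x ≢ y → x ≢ z → y ≢ z →
     (B x y ≡ false) ⊎ (B x z ≡ false) ⊎ (B y z ≡ false))

Sᵥ : ∀ {n} → (F2^ n → F2^ n → Bool) → List (F2^ n) → F2^ n → List (F2^ n)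
Sᵥ B S v = filter (λ x → ¬? (x ≟v v) ×-dec (B x v BoolP.≟ true)) S

dotBound : ℕ → ℕ
dotBound n with n ≤? 7
... | Relation.Nullary.yes _ = n
... | Relation.Nullary.no _ with n % 2
...   | zero = 2 ^ (n / 2 ∸ 1)
...   | suc _ = 1 + 2 ^ ((n ∸ 1) / 2 ∸ 1)

{-# OPTIONS --safe #-}
module Submission where

-- Let T = S_v. Two distinct x, y ∈ T are orthogonal: among x, y, v some pair is, and
-- B(x,v) = B(y,v) = 1. Split T into its isotropic part E (B(e,e) = 0) and its anisotropic
-- part O, and let U = span E, so that |U| = 2^k. Every element of T is orthogonal to U.
-- E lies in the coset {x ∈ U : B(x,v) = 1} of the hyperplane U ∩ v⊥, hence 2|E| ≤ |U|.
-- The vectors of O are independent modulo U, so W = span (O ∪ E) has 2^|O| |U| elements,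
-- and W ⊥ U, so non-degeneracy gives |U| |W| ≤ 2^n, i.e. 2k + |O| ≤ n.
-- Maximising |E| + |O| ≤ 2^(k-1) + |O| under 2k + |O| ≤ n gives the bound for the dot
-- product. The hyperbolic form is alternating, so there O = ∅ and |T| ≤ 2^(k-1) ≤ 2^(n/2-1).

open import Defs
open import Algebra.Bundles using (CommutativeRing)
import Algebra.Properties.CommutativeSemigroup as CommutativeSemigroupProperties
open import Data.Bool using (Bool; true; false; _∧_; _∨_; _xor_; not; if_then_else_)
open import Data.Bool.Properties
  using (xor-assoc; xor-comm; xor-identityˡ; xor-identityʳ; xor-same; ∧-comm; ∧-distribˡ-xor;
         ∨-zeroʳ; ⇔→≡; not-involutive; ¬-not; xor-∧-commutativeRing)
  renaming (_≟_ to _≟ᵇ_)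
open import Data.Fin using (Fin; toℕ; zero; suc)
open import Data.List using (List; []; _∷_; _++_; length; filter)
open import Data.List.Properties using (filter-none)
open import Data.List.Membership.Propositional using (_∈_)
open import Data.List.Membership.Propositional.Properties using (∈-++⁻; ∈-filter⁻)
open import Data.List.Relation.Unary.Any using (here; there)
import Data.List.Relation.Unary.All as All
open import Data.List.Relation.Unary.AllPairs using (_∷_)
open import Data.List.Relation.Unary.Unique.Propositional using (Unique)
open import Data.List.Relation.Unary.Unique.Propositional.Properties using (filter⁺)
open import Data.Nat using (ℕ; zero; suc; _+_; _*_; _∸_; _^_; _/_; _%_; _≤_; _<_; z≤n; s≤s)
open import Data.Nat.DivMod using (m≡m%n+[m/n]*n; m%n<n; m*n/n≡m; m/n≡1+[m∸n]/n; /-monoˡ-≤)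
open import Data.Nat.Properties
open import Data.Nat.Tactic.RingSolver using (solve-∀)
open import Data.Product using (_×_; _,_; proj₁; proj₂; Σ-syntax)
open import Data.Sum using (_⊎_; inj₁; inj₂)
open import Data.Vec using ([]; _∷_; zipWith; replicate; map; tabulate)
open import Data.Vec.Properties
  using (zipWith-assoc; zipWith-comm; zipWith-identityˡ; zipWith-identityʳ; tabulate-cong; tabulate-∘)
open import Function using (_∘_; mk⇔)
open import Relation.Binary.PropositionalEquality
open import Relation.Nullary using (¬_; yes; no; does; ¬?)
open import Relation.Nullary.Decidable using (dec-true; dec-false; _×-dec_)
open import Relation.Nullary.Negation using (contradiction)
open import Relation.Unary using (Decidable)

open CommutativeSemigroupProperties +-commutativeSemigroup
  using () renaming (interchange to +-interchange)
open CommutativeSemigroupProperties (CommutativeRing.+-commutativeSemigroup xor-∧-commutativeRing)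
  using () renaming (interchange to xor-interchange)

private variable n m p k : ℕ

∧-intro : ∀ {a b} → a ≡ true → b ≡ true → a ∧ b ≡ true
∧-intro refl refl = refl

∨-introˡ : ∀ {a b} → a ≡ true → a ∨ b ≡ true
∨-introˡ refl = refl

∨-introʳ : ∀ {a b} → b ≡ true → a ∨ b ≡ true
∨-introʳ {a} refl = ∨-zeroʳ a

∨-elim : ∀ {a b} → a ∨ b ≡ true → a ≡ true ⊎ b ≡ true
∨-elim {true} _ = inj₁ refl
∨-elim {false} b≡true = inj₂ b≡true

infixl 6 _⊕_
_⊕_ : F2^ n → F2^ n → F2^ n
_⊕_ = zipWith _xor_

𝟎 : F2^ n
𝟎 = replicate _ false

⊕-assoc : (x y z : F2^ n) → x ⊕ y ⊕ z ≡ x ⊕ (y ⊕ z)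
⊕-assoc = zipWith-assoc xor-assoc

⊕-comm : (x y : F2^ n) → x ⊕ y ≡ y ⊕ x
⊕-comm = zipWith-comm xor-comm

⊕-identityʳ : (x : F2^ n) → x ⊕ 𝟎 ≡ x
⊕-identityʳ = zipWith-identityʳ xor-identityʳ

⊕-self : (x : F2^ n) → x ⊕ x ≡ 𝟎
⊕-self [] = refl
⊕-self (a ∷ x) = cong₂ _∷_ (xor-same a) (⊕-self x)

⊕-cancelʳ : (x a : F2^ n) → x ⊕ a ⊕ a ≡ x
⊕-cancelʳ x a = begin
  x ⊕ a ⊕ a    ≡⟨ ⊕-assoc x a a ⟩
  x ⊕ (a ⊕ a)  ≡⟨ cong (x ⊕_) (⊕-self a) ⟩
  x ⊕ 𝟎        ≡⟨ ⊕-identityʳ x ⟩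
  x            ∎
  where open ≡-Reasoning

⊕-cancelˡ : (x a : F2^ n) → x ⊕ (x ⊕ a) ≡ a
⊕-cancelˡ x a = begin
  x ⊕ (x ⊕ a)  ≡⟨ ⊕-assoc x x a ⟨
  x ⊕ x ⊕ a    ≡⟨ cong (_⊕ a) (⊕-self x) ⟩
  𝟎 ⊕ a        ≡⟨ zipWith-identityˡ xor-identityˡ a ⟩
  a            ∎
  where open ≡-Reasoning

⊕-swapʳ : (x a y : F2^ n) → x ⊕ a ⊕ y ≡ x ⊕ y ⊕ a
⊕-swapʳ x a y = begin
  x ⊕ a ⊕ y    ≡⟨ ⊕-assoc x a y ⟩
  x ⊕ (a ⊕ y)  ≡⟨ cong (x ⊕_) (⊕-comm a y) ⟩
  x ⊕ (y ⊕ a)  ≡⟨ ⊕-assoc x y a ⟨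
  x ⊕ y ⊕ a    ∎
  where open ≡-Reasoning

⊕-cancel-common : (x a y : F2^ n) → (x ⊕ a) ⊕ (y ⊕ a) ≡ x ⊕ y
⊕-cancel-common x a y = begin
  (x ⊕ a) ⊕ (y ⊕ a)  ≡⟨ ⊕-assoc (x ⊕ a) y a ⟨
  x ⊕ a ⊕ y ⊕ a      ≡⟨ cong (_⊕ a) (⊕-swapʳ x a y) ⟩
  x ⊕ y ⊕ a ⊕ a      ≡⟨ ⊕-cancelʳ (x ⊕ y) a ⟩
  x ⊕ y              ∎
  where open ≡-Reasoning

Linear : (F2^ n → Bool) → Set
Linear f = ∀ x y → f (x ⊕ y) ≡ f x xor f y

linear-𝟎 : {f : F2^ n → Bool} → Linear f → f 𝟎 ≡ false
linear-𝟎 {f = f} lin = begin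
  f 𝟎          ≡⟨ cong f (⊕-self 𝟎) ⟨
  f (𝟎 ⊕ 𝟎)    ≡⟨ lin 𝟎 𝟎 ⟩
  f 𝟎 xor f 𝟎  ≡⟨ xor-same (f 𝟎) ⟩
  false        ∎
  where open ≡-Reasoning

dot-comm : (x y : F2^ n) → dot x y ≡ dot y x
dot-comm [] [] = refl
dot-comm (a ∷ x) (b ∷ y) = cong₂ _xor_ (∧-comm a b) (dot-comm x y)

dot-linearʳ : (x : F2^ n) → Linear (dot x)
dot-linearʳ [] [] [] = refl
dot-linearʳ (a ∷ x) (b ∷ y) (c ∷ z) =
  trans (cong₂ _xor_ (∧-distribˡ-xor a b c) (dot-linearʳ x y z))
        (xor-interchange (a ∧ b) (a ∧ c) (dot x y) (dot x z))

dot-𝟎ˡ : (y : F2^ n) → dot 𝟎 y ≡ false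
dot-𝟎ˡ [] = refl
dot-𝟎ˡ (_ ∷ y) = dot-𝟎ˡ y

count : (F2^ n → Bool) → ℕ
count {zero} P = if P [] then 1 else 0
count {suc n} P = count (P ∘ (false ∷_)) + count (P ∘ (true ∷_))

count-cong : {P Q : F2^ n → Bool} → (∀ x → P x ≡ Q x) → count P ≡ count Q
count-cong {zero} P≗Q = cong (λ b → if b then 1 else 0) (P≗Q [])
count-cong {suc n} P≗Q = cong₂ _+_ (count-cong (P≗Q ∘ (false ∷_))) (count-cong (P≗Q ∘ (true ∷_)))

count-mono : {P Q : F2^ n → Bool} → (∀ x → P x ≡ true → Q x ≡ true) → count P ≤ count Q
count-mono {zero} {P} P⊆Q with P [] in P[]
... | false = z≤n
... | true rewrite P⊆Q [] P[] = ≤-refl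
count-mono {suc n} P⊆Q = +-mono-≤ (count-mono (P⊆Q ∘ (false ∷_))) (count-mono (P⊆Q ∘ (true ∷_)))

count≤2^n : (P : F2^ n → Bool) → count P ≤ 2 ^ n
count≤2^n {zero} P with P []
... | true = ≤-refl
... | false = z≤n
count≤2^n {suc n} P = begin
  count (P ∘ (false ∷_)) + count (P ∘ (true ∷_))
    ≤⟨ +-mono-≤ (count≤2^n (P ∘ (false ∷_))) (count≤2^n (P ∘ (true ∷_))) ⟩
  2 ^ n + 2 ^ n
    ≡⟨ cong (2 ^ n +_) (+-identityʳ (2 ^ n)) ⟨
  2 ^ suc n
    ∎
  where open ≤-Reasoning

count-split : (P Q : F2^ n → Bool) →
  count P ≡ count (λ x → P x ∧ not (Q x)) + count (λ x → P x ∧ Q x)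
count-split {zero} P Q with P [] | Q []
... | false | _ = refl
... | true | false = refl
... | true | true = refl
count-split {suc n} P Q =
  trans (cong₂ _+_ (count-split (P ∘ (false ∷_)) (Q ∘ (false ∷_)))
                   (count-split (P ∘ (true ∷_)) (Q ∘ (true ∷_))))
        (+-interchange (count λ x → P (false ∷ x) ∧ not (Q (false ∷ x)))
                       (count λ x → P (false ∷ x) ∧ Q (false ∷ x))
                       (count λ x → P (true ∷ x) ∧ not (Q (true ∷ x)))
                       (count λ x → P (true ∷ x) ∧ Q (true ∷ x)))

count-∨ : (P Q : F2^ n → Bool) → (∀ x → P x ∧ Q x ≡ false) →
  count (λ x → P x ∨ Q x) ≡ count P + count Q
count-∨ {zero} P Q disjoint with P [] | Q [] | disjoint []
... | false | _ | _ = refl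
... | true | false | _ = refl
count-∨ {suc n} P Q disjoint =
  trans (cong₂ _+_ (count-∨ (P ∘ (false ∷_)) (Q ∘ (false ∷_)) (disjoint ∘ (false ∷_)))
                   (count-∨ (P ∘ (true ∷_)) (Q ∘ (true ∷_)) (disjoint ∘ (true ∷_))))
        (+-interchange (count (P ∘ (false ∷_))) (count (Q ∘ (false ∷_)))
                       (count (P ∘ (true ∷_))) (count (Q ∘ (true ∷_))))

count-≤-∨ : (P Q : F2^ n → Bool) → count P + count Q ≤ 2 * count (λ x → P x ∨ Q x)
count-≤-∨ P Q = begin
  count P + count Q      ≤⟨ +-mono-≤ (count-mono {Q = P∨Q} (λ _ → ∨-introˡ))
                                    (count-mono {Q = P∨Q} (λ x → ∨-introʳ {P x})) ⟩
  count P∨Q + count P∨Q  ≡⟨ cong (count P∨Q +_) (+-identityʳ (count P∨Q)) ⟨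
  2 * count P∨Q          ∎
  where
  open ≤-Reasoning
  P∨Q : F2^ _ → Bool
  P∨Q x = P x ∨ Q x

count-⊕ : (P : F2^ n → Bool) (a : F2^ n) → count (λ x → P (x ⊕ a)) ≡ count P
count-⊕ {zero} P [] = refl
count-⊕ {suc n} P (false ∷ a) =
  cong₂ _+_ (count-⊕ (P ∘ (false ∷_)) a) (count-⊕ (P ∘ (true ∷_)) a)
count-⊕ {suc n} P (true ∷ a) =
  trans (+-comm (count λ x → P (true ∷ x ⊕ a)) (count λ x → P (false ∷ x ⊕ a)))
        (cong₂ _+_ (count-⊕ (P ∘ (false ∷_)) a) (count-⊕ (P ∘ (true ∷_)) a))

witness⇒0<count : (P : F2^ n → Bool) {y : F2^ n} → P y ≡ true → 0 < count P
witness⇒0<count P {[]} Py rewrite Py = s≤s z≤n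
witness⇒0<count P {false ∷ y} Py =
  ≤-trans (witness⇒0<count (P ∘ (false ∷_)) Py) (m≤m+n _ (count (P ∘ (true ∷_))))
witness⇒0<count P {true ∷ y} Py =
  ≤-trans (witness⇒0<count (P ∘ (true ∷_)) Py) (m≤n+m _ (count (P ∘ (false ∷_))))

0<count⇒witness : (P : F2^ n → Bool) → 0 < count P → Σ[ y ∈ F2^ n ] P y ≡ true
0<count⇒witness {zero} P 0<count with P [] in P[]
... | true = [] , P[]
... | false = contradiction 0<count λ ()
0<count⇒witness {suc n} P 0<count with count (P ∘ (false ∷_)) in count₀
... | suc _ = let y , Py = 0<count⇒witness (P ∘ (false ∷_)) (subst (0 <_) (sym count₀) (s≤s z≤n))
              in false ∷ y , Py
... | zero = let y , Py = 0<count⇒witness (P ∘ (true ∷_)) 0<count in true ∷ y , Py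

unique⇒length≤count : (P : F2^ n → Bool) {L : List (F2^ n)} → Unique L →
  (∀ {x} → x ∈ L → P x ≡ true) → length L ≤ count P
unique⇒length≤count P {[]} _ _ = z≤n
unique⇒length≤count P {y ∷ L} (y∉L ∷ unique) L⊆P = begin
  1 + length L             ≤⟨ +-mono-≤ (witness⇒0<count P∧≡y y∈P∧≡y)
                                       (unique⇒length≤count P∧≢y unique L⊆P∧≢y) ⟩
  count P∧≡y + count P∧≢y  ≡⟨ +-comm (count P∧≡y) (count P∧≢y) ⟩
  count P∧≢y + count P∧≡y  ≡⟨ count-split P (λ x → does (x ≟v y)) ⟨
  count P                  ∎
  where
  open ≤-Reasoning
  P∧≡y P∧≢y : F2^ _ → Bool
  P∧≡y x = P x ∧ does (x ≟v y)
  P∧≢y x = P x ∧ not (does (x ≟v y))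
  y∈P∧≡y : P∧≡y y ≡ true
  y∈P∧≡y = ∧-intro (L⊆P (here refl)) (dec-true (y ≟v y) refl)
  L⊆P∧≢y : ∀ {x} → x ∈ L → P∧≢y x ≡ true
  L⊆P∧≢y {x} x∈L =
    ∧-intro (L⊆P (there x∈L)) (cong not (dec-false (x ≟v y) (λ x≡y → All.lookup y∉L x∈L (sym x≡y))))

record IsSubspace (U : F2^ n → Bool) : Set where
  field
    𝟎∈ : U 𝟎 ≡ true
    ⊕-closed : ∀ {x y} → U x ≡ true → U y ≡ true → U (x ⊕ y) ≡ true

module _ {U : F2^ n → Bool} (U-sub : IsSubspace U) where
  open IsSubspace U-sub

  subspace-translate : ∀ {a} → U a ≡ true → ∀ x → U (x ⊕ a) ≡ U x
  subspace-translate {a} a∈U x = ⇔→≡ (mk⇔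
    (λ x⊕a∈U → subst (λ z → U z ≡ true) (⊕-cancelʳ x a) (⊕-closed x⊕a∈U a∈U))
    (λ x∈U → ⊕-closed x∈U a∈U))

  module _ {f : F2^ n → Bool} (f-linear : Linear f) where

    count-∧-linear : ∀ {a} → U a ≡ true → f a ≡ true →
      count (λ x → U x ∧ not (f x)) ≡ count (λ x → U x ∧ f x)
    count-∧-linear {a} a∈U fa = begin
      count (λ x → U x ∧ not (f x))              ≡⟨ count-⊕ (λ x → U x ∧ not (f x)) a ⟨
      count (λ x → U (x ⊕ a) ∧ not (f (x ⊕ a)))  ≡⟨ count-cong translate ⟩
      count (λ x → U x ∧ f x)                    ∎
      where
      open ≡-Reasoning
      translate : ∀ x → U (x ⊕ a) ∧ not (f (x ⊕ a)) ≡ U x ∧ f x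
      translate x rewrite subspace-translate a∈U x | f-linear x a | fa | xor-comm (f x) true
        = cong (U x ∧_) (not-involutive (f x))

    twice-length≤count : {L : List (F2^ n)} → Unique L →
      (∀ {x} → x ∈ L → U x ≡ true) → (∀ {x} → x ∈ L → f x ≡ true) → 2 * length L ≤ count U
    twice-length≤count {[]} _ _ _ = z≤n
    twice-length≤count {a ∷ L} unique L⊆U L⊆f = begin
      2 * length (a ∷ L)
        ≤⟨ *-monoʳ-≤ 2 (unique⇒length≤count U∧f unique (λ x∈ → ∧-intro (L⊆U x∈) (L⊆f x∈))) ⟩
      2 * count U∧f
        ≡⟨ cong (count U∧f +_) (+-identityʳ (count U∧f)) ⟩
      count U∧f + count U∧f
        ≡⟨ cong (_+ count U∧f) (count-∧-linear (L⊆U (here refl)) (L⊆f (here refl))) ⟨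
      count (λ x → U x ∧ not (f x)) + count U∧f
        ≡⟨ count-split U f ⟨
      count U
        ∎
      where
      open ≤-Reasoning
      U∧f : F2^ _ → Bool
      U∧f x = U x ∧ f x

subspace-tail : {U : F2^ (suc n) → Bool} → IsSubspace U → IsSubspace (U ∘ (false ∷_))
subspace-tail U-sub = record { 𝟎∈ = 𝟎∈ ; ⊕-closed = ⊕-closed }
  where open IsSubspace U-sub

subspace-halves : {U : F2^ (suc n) → Bool} → IsSubspace U → ∀ {a} → U (true ∷ a) ≡ true →
  count (U ∘ (true ∷_)) ≡ count (U ∘ (false ∷_))
subspace-halves {U = U} U-sub {a} a∈U = begin
  count (U ∘ (true ∷_))                       ≡⟨ count-⊕ (U ∘ (true ∷_)) a ⟨
  count (λ x → U ((false ∷ x) ⊕ (true ∷ a)))  ≡⟨ count-cong (subspace-translate U-sub a∈U ∘ (false ∷_)) ⟩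
  count (U ∘ (false ∷_))                      ∎
  where open ≡-Reasoning

subspace-count-pow2 : {U : F2^ n → Bool} → IsSubspace U → Σ[ k ∈ ℕ ] count U ≡ 2 ^ k
subspace-count-pow2 {zero} U-sub rewrite IsSubspace.𝟎∈ U-sub = 0 , refl
subspace-count-pow2 {suc n} {U} U-sub with subspace-count-pow2 (subspace-tail U-sub)
... | k , count₀≡2^k with count (U ∘ (true ∷_)) ≟ 0
...   | yes count₁≡0 = k , (begin
  count (U ∘ (false ∷_)) + count (U ∘ (true ∷_))   ≡⟨ cong (count (U ∘ (false ∷_)) +_) count₁≡0 ⟩
  count (U ∘ (false ∷_)) + 0                       ≡⟨ +-identityʳ (count (U ∘ (false ∷_))) ⟩
  count (U ∘ (false ∷_))                           ≡⟨ count₀≡2^k ⟩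
  2 ^ k                                            ∎)
  where open ≡-Reasoning
...   | no count₁≢0 = suc k , (begin
  count (U ∘ (false ∷_)) + count (U ∘ (true ∷_))
    ≡⟨ cong (count (U ∘ (false ∷_)) +_) (subspace-halves U-sub a∈U) ⟩
  count (U ∘ (false ∷_)) + count (U ∘ (false ∷_))  ≡⟨ cong₂ _+_ count₀≡2^k count₀≡2^k ⟩
  2 ^ k + 2 ^ k                                    ≡⟨ cong (2 ^ k +_) (+-identityʳ (2 ^ k)) ⟨
  2 ^ suc k                                        ∎)
  where
  open ≡-Reasoning
  a∈U = proj₂ (0<count⇒witness (U ∘ (true ∷_)) (n≢0⇒n>0 count₁≢0))

Orthogonal : (F2^ n → F2^ n → Bool) → (F2^ n → Bool) → (F2^ n → Bool) → Set
Orthogonal B U W = ∀ {x y} → U x ≡ true → W y ≡ true → B x y ≡ false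

dot-orthogonal-tail : {U W : F2^ (suc n) → Bool} → Orthogonal dot U W →
  Orthogonal dot (U ∘ (false ∷_)) (λ y → W (false ∷ y) ∨ W (true ∷ y))
dot-orthogonal-tail {W = W} U⊥W {x} {y} x∈U₀ y∈W₀∨W₁ with W (false ∷ y) in y∈W₀
... | true = U⊥W {false ∷ x} {false ∷ y} x∈U₀ y∈W₀
... | false = U⊥W {false ∷ x} {true ∷ y} x∈U₀ y∈W₀∨W₁

-- dot (true ∷ a) (b ∷ y) = b xor dot a y takes both values as b varies, so not both vanish.
dot-orthogonal-halves-disjoint : {U W : F2^ (suc n) → Bool} → Orthogonal dot U W →
  ∀ {a} → U (true ∷ a) ≡ true → ∀ y → W (false ∷ y) ∧ W (true ∷ y) ≡ false
dot-orthogonal-halves-disjoint {W = W} U⊥W a∈U y with W (false ∷ y) in y∈W₀ | W (true ∷ y) in y∈W₁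
... | false | _ = refl
... | true | false = refl
... | true | true = trans (cong not (sym (U⊥W a∈U y∈W₀))) (U⊥W a∈U y∈W₁)

-- Induction on the first coordinate: either U lies in the hyperplane x₀ = 0, or U has equally
-- many elements on both sides of it and then W meets each line {(0,y), (1,y)} at most once.
dot-orthogonal-bound : {U W : F2^ n → Bool} → IsSubspace U → Orthogonal dot U W →
  count U * count W ≤ 2 ^ n
dot-orthogonal-bound {zero} {U} {W} _ _ = *-mono-≤ (count≤2^n U) (count≤2^n W)
dot-orthogonal-bound {suc n} {U} {W} U-sub U⊥W = ≤-trans halving (*-monoʳ-≤ 2 induction)
  where
  U₀ U₁ W₀ W₁ W₀∨W₁ : F2^ n → Bool
  U₀ = U ∘ (false ∷_)
  U₁ = U ∘ (true ∷_)
  W₀ = W ∘ (false ∷_)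
  W₁ = W ∘ (true ∷_)
  W₀∨W₁ y = W₀ y ∨ W₁ y

  induction : count U₀ * count W₀∨W₁ ≤ 2 ^ n
  induction = dot-orthogonal-bound (subspace-tail U-sub) (dot-orthogonal-tail {U = U} {W} U⊥W)

  halving : count U * count W ≤ 2 * (count U₀ * count W₀∨W₁)
  halving with count U₁ ≟ 0
  ... | yes count₁≡0 = begin
    (count U₀ + count U₁) * (count W₀ + count W₁)
      ≡⟨ cong (λ c → (count U₀ + c) * (count W₀ + count W₁)) count₁≡0 ⟩
    (count U₀ + 0) * (count W₀ + count W₁)         ≤⟨ *-monoʳ-≤ (count U₀ + 0) (count-≤-∨ W₀ W₁) ⟩
    (count U₀ + 0) * (2 * count W₀∨W₁)             ≡⟨ rearrange (count U₀) (count W₀∨W₁) ⟩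
    2 * (count U₀ * count W₀∨W₁)                   ∎
    where
    open ≤-Reasoning
    rearrange : ∀ a b → (a + 0) * (2 * b) ≡ 2 * (a * b)
    rearrange = solve-∀
  ... | no count₁≢0 = begin
    (count U₀ + count U₁) * (count W₀ + count W₁)
      ≡⟨ cong₂ (λ c w → (count U₀ + c) * w) (subspace-halves U-sub a∈U₁)
               (sym (count-∨ W₀ W₁ (dot-orthogonal-halves-disjoint {U = U} {W} U⊥W a∈U₁))) ⟩
    (count U₀ + count U₀) * count W₀∨W₁            ≡⟨ rearrange (count U₀) (count W₀∨W₁) ⟩
    2 * (count U₀ * count W₀∨W₁)                   ∎
    where
    open ≤-Reasoning
    rearrange : ∀ a b → (a + a) * b ≡ 2 * (a * b)
    rearrange = solve-∀
    a∈U₁ = proj₂ (0<count⇒witness U₁ (n≢0⇒n>0 count₁≢0))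

span : List (F2^ n) → F2^ n → Bool
span [] x = does (x ≟v 𝟎)
span (o ∷ L) x = span L x ∨ span L (x ⊕ o)

span[]⇒𝟎 : {x : F2^ n} → span [] x ≡ true → x ≡ 𝟎
span[]⇒𝟎 {x = x} x∈span with x ≟v 𝟎 | x∈span
... | yes x≡𝟎 | _ = x≡𝟎
... | no _ | ()

𝟎∈span : (L : List (F2^ n)) → span L 𝟎 ≡ true
𝟎∈span {n} [] = dec-true (𝟎 {n} ≟v 𝟎) refl
𝟎∈span (o ∷ L) = ∨-introˡ (𝟎∈span L)

span-⊕-closed : (L : List (F2^ n)) {x y : F2^ n} →
  span L x ≡ true → span L y ≡ true → span L (x ⊕ y) ≡ true
span-⊕-closed {n} [] {x} {y} x∈ y∈ =
  dec-true ((x ⊕ y) ≟v 𝟎) (trans (cong₂ _⊕_ (span[]⇒𝟎 x∈) (span[]⇒𝟎 y∈)) (⊕-self (𝟎 {n})))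
span-⊕-closed (o ∷ L) {x} {y} x∈ y∈ with ∨-elim x∈ | ∨-elim y∈
... | inj₁ x∈L   | inj₁ y∈L   = ∨-introˡ (span-⊕-closed L x∈L y∈L)
... | inj₁ x∈L   | inj₂ y⊕o∈L =
  ∨-introʳ (subst (λ z → span L z ≡ true) (sym (⊕-assoc x y o)) (span-⊕-closed L x∈L y⊕o∈L))
... | inj₂ x⊕o∈L | inj₁ y∈L   =
  ∨-introʳ (subst (λ z → span L z ≡ true) (⊕-swapʳ x o y) (span-⊕-closed L x⊕o∈L y∈L))
... | inj₂ x⊕o∈L | inj₂ y⊕o∈L =
  ∨-introˡ (subst (λ z → span L z ≡ true) (⊕-cancel-common x o y) (span-⊕-closed L x⊕o∈L y⊕o∈L))

span-subspace : (L : List (F2^ n)) → IsSubspace (span L)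
span-subspace L = record { 𝟎∈ = 𝟎∈span L ; ⊕-closed = span-⊕-closed L }

∈⇒∈span : {L : List (F2^ n)} {e : F2^ n} → e ∈ L → span L e ≡ true
∈⇒∈span {L = o ∷ L} (here refl) = ∨-introʳ (subst (λ z → span L z ≡ true) (sym (⊕-self o)) (𝟎∈span L))
∈⇒∈span {L = o ∷ L} (there e∈L) = ∨-introˡ (∈⇒∈span e∈L)

span-⊆-kernel : {f : F2^ n → Bool} → Linear f → (L : List (F2^ n)) → (∀ {e} → e ∈ L → f e ≡ false) →
  ∀ {y} → span L y ≡ true → f y ≡ false
span-⊆-kernel {n} {f} lin [] _ y∈ = trans (cong f (span[]⇒𝟎 y∈)) (linear-𝟎 {n} {f} lin)
span-⊆-kernel {f = f} lin (o ∷ L) L⊆ker {y} y∈ with ∨-elim y∈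
... | inj₁ y∈L = span-⊆-kernel lin L (L⊆ker ∘ there) y∈L
... | inj₂ y⊕o∈L = begin
  f y                ≡⟨ xor-identityʳ (f y) ⟨
  f y xor false      ≡⟨ cong (f y xor_) (L⊆ker (here refl)) ⟨
  f y xor f o        ≡⟨ lin y o ⟨
  f (y ⊕ o)          ≡⟨ span-⊆-kernel lin L (L⊆ker ∘ there) y⊕o∈L ⟩
  false              ∎
  where open ≡-Reasoning

span-∷-count : (L : List (F2^ n)) {o : F2^ n} → span L o ≡ false →
  count (span (o ∷ L)) ≡ 2 * count (span L)
span-∷-count L {o} o∉span = begin
  count (λ x → span L x ∨ span L (x ⊕ o))        ≡⟨ count-∨ (span L) (λ x → span L (x ⊕ o)) disjoint ⟩
  count (span L) + count (λ x → span L (x ⊕ o))  ≡⟨ cong (count (span L) +_) (count-⊕ (span L) o) ⟩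
  count (span L) + count (span L)                ≡⟨ cong (count (span L) +_) (+-identityʳ _) ⟨
  2 * count (span L)                             ∎
  where
  open ≡-Reasoning
  disjoint : ∀ x → span L x ∧ span L (x ⊕ o) ≡ false
  disjoint x with span L x in x∈ | span L (x ⊕ o) in x⊕o∈
  ... | false | _ = refl
  ... | true | false = refl
  ... | true | true =
    trans (sym (subst (λ z → span L z ≡ true) (⊕-cancelˡ x o) (span-⊕-closed L x∈ x⊕o∈))) o∉span

record NondegenerateSymmetricForm (n : ℕ) : Set where
  field
    B : F2^ n → F2^ n → Bool
    B-sym : ∀ x y → B x y ≡ B y x
    B-linear : ∀ x → Linear (B x)
    -- For a symmetric form this is equivalent to non-degeneracy: it says dim U + dim U⊥ ≤ n.
    orthogonal-bound : {U W : F2^ n → Bool} → IsSubspace U → Orthogonal B U W → count U * count W ≤ 2 ^ n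

  span-orthogonal : {L M : List (F2^ n)} → (∀ {x y} → x ∈ L → y ∈ M → B x y ≡ false) →
    Orthogonal B (span L) (span M)
  span-orthogonal {L} {M} L⊥M {x} x∈ = span-⊆-kernel (B-linear x) M x⊥M
    where
    x⊥M : ∀ {y} → y ∈ M → B x y ≡ false
    x⊥M {y} y∈M =
      trans (B-sym x y) (span-⊆-kernel (B-linear y) L (λ x'∈L → trans (B-sym y _) (L⊥M x'∈L y∈M)) x∈)

  count-span-anisotropic : (L : List (F2^ n)) {O : List (F2^ n)} → Unique O →
    (∀ {o} → o ∈ O → B o o ≡ true) →
    (∀ {o o'} → o ∈ O → o' ∈ O → o ≢ o' → B o o' ≡ false) →
    (∀ {o e} → o ∈ O → e ∈ L → B o e ≡ false) →
    count (span (O ++ L)) ≡ 2 ^ length O * count (span L)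
  count-span-anisotropic L {[]} _ _ _ _ = sym (+-identityʳ (count (span L)))
  count-span-anisotropic L {o ∷ O} (o∉O ∷ unique) anisotropic O-orth O⊥L = begin
    count (span (o ∷ O ++ L))            ≡⟨ span-∷-count (O ++ L) o∉span ⟩
    2 * count (span (O ++ L))            ≡⟨ cong (2 *_) induction ⟩
    2 * (2 ^ length O * count (span L))  ≡⟨ *-assoc 2 (2 ^ length O) (count (span L)) ⟨
    2 ^ length (o ∷ O) * count (span L)  ∎
    where
    open ≡-Reasoning
    induction : count (span (O ++ L)) ≡ 2 ^ length O * count (span L)
    induction = count-span-anisotropic L unique (anisotropic ∘ there)
      (λ o∈ o'∈ → O-orth (there o∈) (there o'∈)) (O⊥L ∘ there)
    o⊥O++L : ∀ {e} → e ∈ O ++ L → B o e ≡ false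
    o⊥O++L e∈ with ∈-++⁻ O e∈
    ... | inj₁ e∈O = O-orth (here refl) (there e∈O) (λ o≡e → All.lookup o∉O e∈O o≡e)
    ... | inj₂ e∈L = O⊥L (here refl) e∈L
    -- B o vanishes on span (O ++ L) but not at o.
    o∉span : span (O ++ L) o ≡ false
    o∉span with span (O ++ L) o in o∈
    ... | false = refl
    ... | true = trans (sym (anisotropic (here refl))) (span-⊆-kernel (B-linear o) (O ++ L) o⊥O++L o∈)

length-filter-split : {A : Set} {P : A → Set} (P? : Decidable P) (xs : List A) →
  length xs ≡ length (filter P? xs) + length (filter (¬? ∘ P?) xs)
length-filter-split P? [] = refl
length-filter-split P? (x ∷ xs) with does (P? x)
... | true = cong suc (length-filter-split P? xs)
... | false = trans (cong suc (length-filter-split P? xs)) (sym (+-suc _ _))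

2^-cancel-≤ : ∀ {a b} → 2 ^ a ≤ 2 ^ b → a ≤ b
2^-cancel-≤ 2^a≤2^b = ≮⇒≥ (λ b<a → <⇒≱ (^-monoʳ-< 2 (s≤s (s≤s z≤n)) b<a) 2^a≤2^b)

module PairwiseOrthogonal (F : NondegenerateSymmetricForm n) (v : F2^ n) {T : List (F2^ n)}
  (T-unique : Unique T)
  (T-v : ∀ {x} → x ∈ T → NondegenerateSymmetricForm.B F x v ≡ true)
  (T-orth : ∀ {x y} → x ∈ T → y ∈ T → x ≢ y → NondegenerateSymmetricForm.B F x y ≡ false)
  where
  open NondegenerateSymmetricForm F

  isotropic? : Decidable (λ x → B x x ≡ false)
  isotropic? x = B x x ≟ᵇ false

  E O : List (F2^ n)
  E = filter isotropic? T
  O = filter (¬? ∘ isotropic?) T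

  length-T : length T ≡ length E + length O
  length-T = length-filter-split isotropic? T

  E⊆T : ∀ {e} → e ∈ E → e ∈ T
  E⊆T = proj₁ ∘ ∈-filter⁻ isotropic? {xs = T}

  O⊆T : ∀ {o} → o ∈ O → o ∈ T
  O⊆T = proj₁ ∘ ∈-filter⁻ (¬? ∘ isotropic?) {xs = T}

  O-anisotropic : ∀ {o} → o ∈ O → B o o ≡ true
  O-anisotropic = ¬-not ∘ proj₂ ∘ ∈-filter⁻ (¬? ∘ isotropic?) {xs = T}

  T⊥E : ∀ {x e} → x ∈ T → e ∈ E → B x e ≡ false
  T⊥E {x} {e} x∈T e∈E with x ≟v e
  ... | yes refl = proj₂ (∈-filter⁻ isotropic? {xs = T} e∈E)
  ... | no x≢e = T-orth x∈T (E⊆T e∈E) x≢e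

  2∣E∣≤∣spanE∣ : 2 * length E ≤ count (span E)
  2∣E∣≤∣spanE∣ = twice-length≤count (span-subspace E) (B-linear v) (filter⁺ isotropic? {T} T-unique)
    ∈⇒∈span (λ e∈E → trans (B-sym v _) (T-v (E⊆T e∈E)))

  ∣span[O++E]∣ : count (span (O ++ E)) ≡ 2 ^ length O * count (span E)
  ∣span[O++E]∣ = count-span-anisotropic E (filter⁺ (¬? ∘ isotropic?) {T} T-unique) O-anisotropic
    (λ o∈O o'∈O → T-orth (O⊆T o∈O) (O⊆T o'∈O)) (T⊥E ∘ O⊆T)

  spanE⊥span[O++E] : Orthogonal B (span E) (span (O ++ E))
  spanE⊥span[O++E] = span-orthogonal (λ e∈E y∈ → trans (B-sym _ _) (T⊥E (O++E⊆T y∈) e∈E))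
    where
    O++E⊆T : ∀ {y} → y ∈ O ++ E → y ∈ T
    O++E⊆T y∈ with ∈-++⁻ O y∈
    ... | inj₁ y∈O = O⊆T y∈O
    ... | inj₂ y∈E = E⊆T y∈E

  dimension-bound : Σ[ k ∈ ℕ ] 2 * length E ≤ 2 ^ k × k + length O + k ≤ n
  dimension-bound with k , ∣spanE∣≡2^k ← subspace-count-pow2 (span-subspace E) =
    k , subst (2 * length E ≤_) ∣spanE∣≡2^k 2∣E∣≤∣spanE∣ , 2^-cancel-≤ (begin
      2 ^ (k + length O + k)
        ≡⟨ 2^[a+b+a] k (length O) ⟩
      2 ^ k * (2 ^ length O * 2 ^ k)
        ≡⟨ cong₂ (λ u w → u * (2 ^ length O * w)) ∣spanE∣≡2^k ∣spanE∣≡2^k ⟨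
      count (span E) * (2 ^ length O * count (span E))
        ≡⟨ cong (count (span E) *_) ∣span[O++E]∣ ⟨
      count (span E) * count (span (O ++ E))
        ≤⟨ orthogonal-bound (span-subspace E) spanE⊥span[O++E] ⟩
      2 ^ n
        ∎)
    where
    open ≤-Reasoning
    2^[a+b+a] : ∀ a b → 2 ^ (a + b + a) ≡ 2 ^ a * (2 ^ b * 2 ^ a)
    2^[a+b+a] a b = begin-equality
      2 ^ (a + b + a)        ≡⟨ ^-distribˡ-+-* 2 (a + b) a ⟩
      2 ^ (a + b) * 2 ^ a    ≡⟨ cong (_* 2 ^ a) (^-distribˡ-+-* 2 a b) ⟩
      2 ^ a * 2 ^ b * 2 ^ a  ≡⟨ *-assoc (2 ^ a) (2 ^ b) (2 ^ a) ⟩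
      2 ^ a * (2 ^ b * 2 ^ a) ∎

  alternating⇒length-T≡length-E : (∀ x → B x x ≡ false) → length T ≡ length E
  alternating⇒length-T≡length-E alternating = begin
    length T               ≡⟨ length-T ⟩
    length E + length O    ≡⟨ cong (λ O → length E + length O) O≡[] ⟩
    length E + 0           ≡⟨ +-identityʳ (length E) ⟩
    length E               ∎
    where
    open ≡-Reasoning
    O≡[] : O ≡ []
    O≡[] = filter-none (¬? ∘ isotropic?) {T}
      (All.tabulate λ {x} _ anisotropic → anisotropic (alternating x))

dot-form : NondegenerateSymmetricForm n
dot-form = record
  { B = dot
  ; B-sym = dot-comm
  ; B-linear = dot-linearʳ
  ; orthogonal-bound = dot-orthogonal-bound
  }

swapPairs : F2^ n → F2^ n
swapPairs [] = []
swapPairs (a ∷ []) = a ∷ []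
swapPairs (a ∷ b ∷ x) = b ∷ a ∷ swapPairs x

swapPairs-involutive : (x : F2^ n) → swapPairs (swapPairs x) ≡ x
swapPairs-involutive [] = refl
swapPairs-involutive (a ∷ []) = refl
swapPairs-involutive (a ∷ b ∷ x) = cong (λ y → a ∷ b ∷ y) (swapPairs-involutive x)

swapPairs-⊕ : (x y : F2^ n) → swapPairs (x ⊕ y) ≡ swapPairs x ⊕ swapPairs y
swapPairs-⊕ [] [] = refl
swapPairs-⊕ (a ∷ []) (c ∷ []) = refl
swapPairs-⊕ (a ∷ b ∷ x) (c ∷ d ∷ y) = cong (λ z → (b xor d) ∷ (a xor c) ∷ z) (swapPairs-⊕ x y)

dot-swapPairs : (x y : F2^ n) → dot x (swapPairs y) ≡ dot (swapPairs x) y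
dot-swapPairs [] [] = refl
dot-swapPairs (a ∷ []) (c ∷ []) = refl
dot-swapPairs (a ∷ b ∷ x) (c ∷ d ∷ y) = begin
  (a ∧ d) xor ((b ∧ c) xor dot x (swapPairs y))
    ≡⟨ xor-assoc (a ∧ d) (b ∧ c) _ ⟨
  ((a ∧ d) xor (b ∧ c)) xor dot x (swapPairs y)
    ≡⟨ cong₂ _xor_ (xor-comm (a ∧ d) (b ∧ c)) (dot-swapPairs x y) ⟩
  ((b ∧ c) xor (a ∧ d)) xor dot (swapPairs x) y
    ≡⟨ xor-assoc (b ∧ c) (a ∧ d) _ ⟩
  (b ∧ c) xor ((a ∧ d) xor dot (swapPairs x) y)
    ∎
  where open ≡-Reasoning

count-swapPairs : (P : F2^ n → Bool) → count (P ∘ swapPairs) ≡ count P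
count-swapPairs {zero} P = refl
count-swapPairs {suc zero} P = refl
count-swapPairs {suc (suc n)} P =
  trans (cong₂ _+_ (cong₂ _+_ (count-swapPairs P₀₀) (count-swapPairs P₁₀))
                   (cong₂ _+_ (count-swapPairs P₀₁) (count-swapPairs P₁₁)))
        (+-interchange (count P₀₀) (count P₁₀) (count P₀₁) (count P₁₁))
  where
  P₀₀ P₀₁ P₁₀ P₁₁ : F2^ n → Bool
  P₀₀ x = P (false ∷ false ∷ x)
  P₀₁ x = P (false ∷ true ∷ x)
  P₁₀ x = P (true ∷ false ∷ x)
  P₁₁ x = P (true ∷ true ∷ x)

hypEntry : ℕ → ℕ → Bool
hypEntry a b = does (¬? (a ≟ b)) ∧ does ((a / 2) ≟ (b / 2))

[2+a]/2 : ∀ a → (2 + a) / 2 ≡ 1 + a / 2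
[2+a]/2 a = m/n≡1+[m∸n]/n {2 + a} {2} (s≤s (s≤s z≤n))

hypEntry-ss-ss : ∀ a b → hypEntry (2 + a) (2 + b) ≡ hypEntry a b
hypEntry-ss-ss a b rewrite [2+a]/2 a | [2+a]/2 b = refl

hypEntry-0-ss : ∀ b → hypEntry 0 (2 + b) ≡ false
hypEntry-0-ss b rewrite [2+a]/2 b = refl

hypEntry-1-ss : ∀ b → hypEntry 1 (2 + b) ≡ false
hypEntry-1-ss b rewrite [2+a]/2 b = refl

hypEntry-ss-0 : ∀ a → hypEntry (2 + a) 0 ≡ false
hypEntry-ss-0 a rewrite [2+a]/2 a = refl

hypEntry-ss-1 : ∀ a → hypEntry (2 + a) 1 ≡ false
hypEntry-ss-1 a rewrite [2+a]/2 a = refl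

tabulate-false : {f : Fin n → Bool} → (∀ j → f j ≡ false) → tabulate f ≡ 𝟎
tabulate-false {zero} _ = refl
tabulate-false {suc n} f≡false = cong₂ _∷_ (f≡false zero) (tabulate-false (f≡false ∘ suc))

-- hypMat n is definitionally tabulate λ i → hypRow (toℕ i) n.
hypRow : ℕ → (n : ℕ) → F2^ n
hypRow i n = tabulate λ j → hypEntry i (toℕ j)

dot-hypRow-0 : (c d : Bool) (y : F2^ n) → dot (hypRow 0 (2 + n)) (c ∷ d ∷ y) ≡ d
dot-hypRow-0 c d y = begin
  d xor dot (tabulate λ j → hypEntry 0 (2 + toℕ j)) y
    ≡⟨ cong (λ r → d xor dot r y) (tabulate-false (hypEntry-0-ss ∘ toℕ)) ⟩
  d xor dot 𝟎 y                                       ≡⟨ cong (d xor_) (dot-𝟎ˡ y) ⟩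
  d xor false                                         ≡⟨ xor-identityʳ d ⟩
  d                                                   ∎
  where open ≡-Reasoning

dot-hypRow-1 : (c d : Bool) (y : F2^ n) → dot (hypRow 1 (2 + n)) (c ∷ d ∷ y) ≡ c
dot-hypRow-1 c d y = begin
  c xor dot (tabulate λ j → hypEntry 1 (2 + toℕ j)) y
    ≡⟨ cong (λ r → c xor dot r y) (tabulate-false (hypEntry-1-ss ∘ toℕ)) ⟩
  c xor dot 𝟎 y                                       ≡⟨ cong (c xor_) (dot-𝟎ˡ y) ⟩
  c xor false                                         ≡⟨ xor-identityʳ c ⟩
  c                                                   ∎
  where open ≡-Reasoning

dot-hypRow-ss : ∀ i (c d : Bool) (y : F2^ n) →
  dot (hypRow (2 + i) (2 + n)) (c ∷ d ∷ y) ≡ dot (hypRow i n) y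
dot-hypRow-ss i c d y = begin
  (hypEntry (2 + i) 0 ∧ c) xor ((hypEntry (2 + i) 1 ∧ d) xor dot rest y)
    ≡⟨ cong₂ (λ p q → (p ∧ c) xor ((q ∧ d) xor dot rest y)) (hypEntry-ss-0 i) (hypEntry-ss-1 i) ⟩
  dot rest y
    ≡⟨ cong (λ r → dot r y) (tabulate-cong (hypEntry-ss-ss i ∘ toℕ)) ⟩
  dot (hypRow i _) y
    ∎
  where
  open ≡-Reasoning
  rest = tabulate λ j → hypEntry (2 + i) (2 + toℕ j)

hypMat-apply : n % 2 ≡ 0 → (y : F2^ n) → map (λ row → dot row y) (hypMat n) ≡ swapPairs y
hypMat-apply {zero} _ [] = refl
hypMat-apply {suc zero} () _
hypMat-apply {suc (suc n)} even (c ∷ d ∷ y) =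
  cong₂ _∷_ (dot-hypRow-0 c d y) (cong₂ _∷_ (dot-hypRow-1 c d y) (begin
    map (λ row → dot row (c ∷ d ∷ y)) (tabulate λ i → hypRow (2 + toℕ i) (2 + n))
      ≡⟨ tabulate-∘ (λ row → dot row (c ∷ d ∷ y)) _ ⟨
    tabulate (λ i → dot (hypRow (2 + toℕ i) (2 + n)) (c ∷ d ∷ y))
      ≡⟨ tabulate-cong (λ i → dot-hypRow-ss (toℕ i) c d y) ⟩
    tabulate (λ i → dot (hypRow (toℕ i) n) y)
      ≡⟨ tabulate-∘ (λ row → dot row y) _ ⟩
    map (λ row → dot row y) (hypMat n)
      ≡⟨ hypMat-apply even y ⟩
    swapPairs y
      ∎))
  where open ≡-Reasoning

hyp≡dot-swapPairs : n % 2 ≡ 0 → (x y : F2^ n) → hyp x y ≡ dot x (swapPairs y)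
hyp≡dot-swapPairs even x y = cong (dot x) (hypMat-apply even y)

hyp-form : n % 2 ≡ 0 → NondegenerateSymmetricForm n
hyp-form {n} even = record
  { B = hyp
  ; B-sym = hyp-sym
  ; B-linear = hyp-linear
  ; orthogonal-bound = hyp-orthogonal-bound
  }
  where
  open ≡-Reasoning
  hyp-sym : (x y : F2^ n) → hyp x y ≡ hyp y x
  hyp-sym x y = begin
    hyp x y              ≡⟨ hyp≡dot-swapPairs even x y ⟩
    dot x (swapPairs y)  ≡⟨ dot-swapPairs x y ⟩
    dot (swapPairs x) y  ≡⟨ dot-comm (swapPairs x) y ⟩
    dot y (swapPairs x)  ≡⟨ hyp≡dot-swapPairs even y x ⟨
    hyp y x              ∎
  hyp-linear : (x : F2^ n) → Linear (hyp x)
  hyp-linear x y z = begin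
    hyp x (y ⊕ z)                                ≡⟨ hyp≡dot-swapPairs even x (y ⊕ z) ⟩
    dot x (swapPairs (y ⊕ z))                    ≡⟨ cong (dot x) (swapPairs-⊕ y z) ⟩
    dot x (swapPairs y ⊕ swapPairs z)            ≡⟨ dot-linearʳ x (swapPairs y) (swapPairs z) ⟩
    dot x (swapPairs y) xor dot x (swapPairs z)  ≡⟨ cong₂ _xor_ (hyp≡dot-swapPairs even x y)
                                                                (hyp≡dot-swapPairs even x z) ⟨
    hyp x y xor hyp x z                          ∎
  hyp-orthogonal-bound : {U W : F2^ n → Bool} → IsSubspace U → Orthogonal hyp U W →
    count U * count W ≤ 2 ^ n
  hyp-orthogonal-bound {U} {W} U-sub U⊥W =
    subst (λ c → count U * c ≤ 2 ^ n) (count-swapPairs W) (dot-orthogonal-bound U-sub U⊥W∘swapPairs)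
    where
    U⊥W∘swapPairs : Orthogonal dot U (W ∘ swapPairs)
    U⊥W∘swapPairs {x} {y} x∈U swapPairs-y∈W = begin
      dot x y                          ≡⟨ cong (dot x) (swapPairs-involutive y) ⟨
      dot x (swapPairs (swapPairs y))  ≡⟨ hyp≡dot-swapPairs even x (swapPairs y) ⟨
      hyp x (swapPairs y)              ≡⟨ U⊥W x∈U swapPairs-y∈W ⟩
      false                            ∎

dot-swapPairs-self : n % 2 ≡ 0 → (x : F2^ n) → dot x (swapPairs x) ≡ false
dot-swapPairs-self {zero} _ [] = refl
dot-swapPairs-self {suc zero} () _
dot-swapPairs-self {suc (suc n)} even (a ∷ b ∷ x) = begin
  (a ∧ b) xor ((b ∧ a) xor dot x (swapPairs x))
    ≡⟨ cong₂ (λ p q → (a ∧ b) xor (p xor q)) (∧-comm b a) (dot-swapPairs-self even x) ⟩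
  (a ∧ b) xor ((a ∧ b) xor false)
    ≡⟨ xor-assoc (a ∧ b) (a ∧ b) false ⟨
  ((a ∧ b) xor (a ∧ b)) xor false
    ≡⟨ cong (_xor false) (xor-same (a ∧ b)) ⟩
  false
    ∎
  where open ≡-Reasoning

hyp-alternating : n % 2 ≡ 0 → (x : F2^ n) → hyp x x ≡ false
hyp-alternating even x = trans (hyp≡dot-swapPairs even x x) (dot-swapPairs-self even x)

module _ {B : F2^ n → F2^ n → Bool} {S : List (F2^ n)} {v : F2^ n} where

  private
    Sᵥ? = λ x → ¬? (x ≟v v) ×-dec (B x v ≟ᵇ true)

  Sᵥ-unique : Unique S → Unique (Sᵥ B S v)
  Sᵥ-unique = filter⁺ Sᵥ?

  Sᵥ⁻ : ∀ {x} → x ∈ Sᵥ B S v → x ∈ S × x ≢ v × B x v ≡ true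
  Sᵥ⁻ = ∈-filter⁻ Sᵥ? {xs = S}

  Sᵥ-orthogonal : ThreeTwoOrthogonal B S → v ∈ S →
    ∀ {x y} → x ∈ Sᵥ B S v → y ∈ Sᵥ B S v → x ≢ y → B x y ≡ false
  Sᵥ-orthogonal (_ , _ , two-of-three) v∈S x∈ y∈ x≢y
    with x∈S , x≢v , Bxv ← Sᵥ⁻ x∈ | y∈S , y≢v , Byv ← Sᵥ⁻ y∈
    with two-of-three x∈S y∈S v∈S x≢y x≢v y≢v
  ... | inj₁ Bxy≡false = Bxy≡false
  ... | inj₂ (inj₁ Bxv≡false) = contradiction (trans (sym Bxv) Bxv≡false) λ ()
  ... | inj₂ (inj₂ Byv≡false) = contradiction (trans (sym Byv) Byv≡false) λ ()

module SᵥSplit {n : ℕ} (F : NondegenerateSymmetricForm n) {S : List (F2^ n)}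
  (S-orth : ThreeTwoOrthogonal (NondegenerateSymmetricForm.B F) S) {v : F2^ n} (v∈S : v ∈ S) =
  PairwiseOrthogonal F v (Sᵥ-unique {B = NondegenerateSymmetricForm.B F} (proj₁ S-orth))
    (proj₂ ∘ proj₂ ∘ Sᵥ⁻ {B = NondegenerateSymmetricForm.B F} {S}) (Sᵥ-orthogonal S-orth v∈S)

n≡n%2+n/2*2 : ∀ n → n ≡ n % 2 + n / 2 * 2
n≡n%2+n/2*2 n = m≡m%n+[m/n]*n n 2

n%2≤1 : ∀ n → n % 2 ≤ 1
n%2≤1 n = ≤-pred (m%n<n n 2)

[n∸1]/2≡n/2 : n % 2 ≡ 1 → (n ∸ 1) / 2 ≡ n / 2
[n∸1]/2≡n/2 {n} odd = begin
  (n ∸ 1) / 2                   ≡⟨ cong (λ x → (x ∸ 1) / 2) (n≡n%2+n/2*2 n) ⟩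
  (n % 2 + n / 2 * 2 ∸ 1) / 2   ≡⟨ cong (λ r → (r + n / 2 * 2 ∸ 1) / 2) odd ⟩
  n / 2 * 2 / 2                 ≡⟨ m*n/n≡m (n / 2) 2 ⟩
  n / 2                         ∎
  where open ≡-Reasoning

dotBound-≤7 : n ≤ 7 → dotBound n ≡ n
dotBound-≤7 {n} n≤7 with n ≤? 7
... | yes _ = refl
... | no n≰7 = contradiction n≤7 n≰7

dotBound->7 : ¬ n ≤ 7 → dotBound n ≡ 2 ^ (n / 2 ∸ 1) + n % 2
dotBound->7 {n} n≰7 with n ≤? 7
... | yes n≤7 = contradiction n≤7 n≰7
... | no _ with n % 2 in r
...   | zero = sym (+-identityʳ _)
...   | suc zero = trans (cong (λ h → 1 + 2 ^ (h ∸ 1)) ([n∸1]/2≡n/2 {n} r)) (+-comm 1 (2 ^ (n / 2 ∸ 1)))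
...   | suc (suc _) = contradiction (subst (_≤ 1) r (n%2≤1 n)) λ { (s≤s ()) }

grow : ∀ {a} j → 2 ≤ a → a + j * 2 ≤ a * 2 ^ j
grow {a} zero _ = ≤-reflexive (trans (+-identityʳ a) (sym (*-identityʳ a)))
grow {a} (suc j) 2≤a = begin
  a + suc j * 2          ≡⟨ rearrange a j ⟩
  (a + j * 2) + 2        ≤⟨ +-mono-≤ (grow j 2≤a) (≤-trans 2≤a a≤a*2^j) ⟩
  a * 2 ^ j + a * 2 ^ j  ≡⟨ double a (2 ^ j) ⟩
  a * 2 ^ suc j          ∎
  where
  open ≤-Reasoning
  rearrange : ∀ a j → a + suc j * 2 ≡ (a + j * 2) + 2
  rearrange = solve-∀
  double : ∀ a x → a * x + a * x ≡ a * (2 * x)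
  double = solve-∀
  a≤a*2^j : a ≤ a * 2 ^ j
  a≤a*2^j = ≤-trans (≤-reflexive (sym (*-identityʳ a))) (*-monoʳ-≤ a (m^n>0 2 j))

2^[K∸1]≤K*2 : ∀ {K} → 1 ≤ K → K ≤ 3 → 2 ^ (K ∸ 1) ≤ K * 2
2^[K∸1]≤K*2 {1} _ _ = ≤ᵇ⇒≤ 1 2 _
2^[K∸1]≤K*2 {2} _ _ = ≤ᵇ⇒≤ 2 4 _
2^[K∸1]≤K*2 {3} _ _ = ≤ᵇ⇒≤ 4 6 _
2^[K∸1]≤K*2 {suc (suc (suc (suc _)))} _ (s≤s (s≤s (s≤s ())))

K*2≤2^[K∸1] : ∀ {K} → 4 ≤ K → K * 2 ≤ 2 ^ (K ∸ 1)
K*2≤2^[K∸1] {suc (suc (suc (suc j)))} _ = begin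
  (4 + j) * 2    ≡⟨ *-distribʳ-+ 2 4 j ⟩
  8 + j * 2      ≤⟨ grow j (≤ᵇ⇒≤ 2 8 _) ⟩
  8 * 2 ^ j      ≡⟨ ^-distribˡ-+-* 2 3 j ⟨
  2 ^ (3 + j)    ∎
  where open ≤-Reasoning
K*2≤2^[K∸1] {0} ()
K*2≤2^[K∸1] {1} (s≤s ())
K*2≤2^[K∸1] {2} (s≤s (s≤s ()))
K*2≤2^[K∸1] {3} (s≤s (s≤s (s≤s ())))

-- For n ≥ 2, dotBound n = max n (2^(⌊n/2⌋-1) + n % 2); 2⌊n/2⌋ and 2^(⌊n/2⌋-1) cross at n = 8.
n≤dotBound : ∀ n → n ≤ dotBound n
n≤dotBound n with ≤-<-connex n 7
... | inj₁ n≤7 = ≤-reflexive (sym (dotBound-≤7 n≤7))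
... | inj₂ 7<n = begin
  n                          ≡⟨ n≡n%2+n/2*2 n ⟩
  n % 2 + n / 2 * 2          ≤⟨ +-monoʳ-≤ (n % 2) (K*2≤2^[K∸1] (/-monoˡ-≤ 2 7<n)) ⟩
  n % 2 + 2 ^ (n / 2 ∸ 1)    ≡⟨ +-comm (n % 2) _ ⟩
  2 ^ (n / 2 ∸ 1) + n % 2    ≡⟨ dotBound->7 (<⇒≱ 7<n) ⟨
  dotBound n                 ∎
  where open ≤-Reasoning

pow≤dotBound : ∀ n → 1 ≤ n / 2 → 2 ^ (n / 2 ∸ 1) + n % 2 ≤ dotBound n
pow≤dotBound n 1≤K with ≤-<-connex n 7
... | inj₂ 7<n = ≤-reflexive (sym (dotBound->7 (<⇒≱ 7<n)))
... | inj₁ n≤7 = begin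
  2 ^ (n / 2 ∸ 1) + n % 2    ≤⟨ +-monoˡ-≤ (n % 2) (2^[K∸1]≤K*2 1≤K (/-monoˡ-≤ 2 n≤7)) ⟩
  n / 2 * 2 + n % 2          ≡⟨ +-comm (n / 2 * 2) (n % 2) ⟩
  n % 2 + n / 2 * 2          ≡⟨ n≡n%2+n/2*2 n ⟨
  n                          ≡⟨ dotBound-≤7 n≤7 ⟨
  dotBound n                 ∎
  where open ≤-Reasoning

half-≤-pow : 2 * m ≤ 2 ^ k → m ≤ 2 ^ (k ∸ 1)
half-≤-pow {k = zero} 2m≤1 = *-cancelˡ-≤ 2 (≤-trans 2m≤1 (≤ᵇ⇒≤ 1 2 _))
half-≤-pow {k = suc k} 2m≤2^[1+k] = *-cancelˡ-≤ 2 2m≤2^[1+k]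

k*2≤k+p+k : ∀ k p → k * 2 ≤ k + p + k
k*2≤k+p+k k p = begin
  k * 2        ≡⟨ *-comm k 2 ⟩
  k + (k + 0)  ≡⟨ cong (k +_) (+-identityʳ k) ⟩
  k + k        ≤⟨ +-monoˡ-≤ k (m≤m+n k p) ⟩
  k + p + k    ∎
  where open ≤-Reasoning

k≤n/2 : k + p + k ≤ n → k ≤ n / 2
k≤n/2 {k} {p} {n} k+p+k≤n = ≤-pred (*-cancelʳ-< 2 k (suc (n / 2)) (begin-strict
  k * 2                 ≤⟨ k*2≤k+p+k k p ⟩
  k + p + k             ≤⟨ k+p+k≤n ⟩
  n                     ≡⟨ n≡n%2+n/2*2 n ⟩
  n % 2 + n / 2 * 2     <⟨ +-monoˡ-< (n / 2 * 2) (s≤s (n%2≤1 n)) ⟩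
  2 + n / 2 * 2         ∎))
  where open ≤-Reasoning

small-k-bound : m ≤ k → k + p + k ≤ n → m + p ≤ n
small-k-bound {m} {k} {p} m≤k k+p+k≤n = begin
  m + p        ≤⟨ +-monoˡ-≤ p m≤k ⟩
  k + p        ≤⟨ m≤m+n (k + p) k ⟩
  k + p + k    ≤⟨ k+p+k≤n ⟩
  _            ∎
  where open ≤-Reasoning

spare-pairs : ∀ {r j} → k + p + k ≤ r + (k + j) * 2 → p ≤ r + j * 2
spare-pairs {k} {p} {r} {j} k+p+k≤ = +-cancelˡ-≤ (k * 2) p (r + j * 2) (begin
  k * 2 + p                ≡⟨ gather k p ⟨
  k + p + k                ≤⟨ k+p+k≤ ⟩
  r + (k + j) * 2          ≡⟨ expand k r j ⟩
  k * 2 + (r + j * 2)      ∎)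
  where
  open ≤-Reasoning
  gather : ∀ k p → k + p + k ≡ k * 2 + p
  gather = solve-∀
  expand : ∀ k r j → r + (k + j) * 2 ≡ k * 2 + (r + j * 2)
  expand = solve-∀

-- For k ≥ 2 the bound 2^(k-1) + (n - 2k) does not decrease with k, so it is worst at k = ⌊n/2⌋.
dotBound-bound : 2 * m ≤ 2 ^ k → k + p + k ≤ n → m + p ≤ dotBound n
dotBound-bound {m} {0} {p} {n} 2m≤1 k+p+k≤n =
  ≤-trans (small-k-bound (≤-pred (*-cancelˡ-< 2 m 1 (s≤s 2m≤1))) k+p+k≤n) (n≤dotBound n)
dotBound-bound {m} {1} {p} {n} 2m≤2 k+p+k≤n =
  ≤-trans (small-k-bound (half-≤-pow {k = 1} 2m≤2) k+p+k≤n) (n≤dotBound n)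
dotBound-bound {m} {k@(suc (suc k'))} {p} {n} 2m≤2^k k+p+k≤n
  with j , k+j≡n/2 ← m≤n⇒∃[o]m+o≡n (k≤n/2 {k} {p} k+p+k≤n) = begin
  m + p                          ≤⟨ +-mono-≤ (half-≤-pow {k = k} 2m≤2^k)
                                              (spare-pairs {k} {p} k+p+k≤r+[k+j]*2) ⟩
  2 ^ suc k' + (n % 2 + j * 2)   ≡⟨ rearrange (2 ^ suc k') (n % 2) j ⟩
  (2 ^ suc k' + j * 2) + n % 2   ≤⟨ +-monoˡ-≤ (n % 2) (grow j (*-monoʳ-≤ 2 (m^n>0 2 k'))) ⟩
  2 ^ suc k' * 2 ^ j + n % 2     ≡⟨ cong (_+ n % 2) (^-distribˡ-+-* 2 (suc k') j) ⟨
  2 ^ (suc k' + j) + n % 2       ≡⟨ cong (λ K → 2 ^ (K ∸ 1) + n % 2) k+j≡n/2 ⟩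
  2 ^ (n / 2 ∸ 1) + n % 2        ≤⟨ pow≤dotBound n (≤-trans (s≤s z≤n) (k≤n/2 {k} {p} k+p+k≤n)) ⟩
  dotBound n                     ∎
  where
  open ≤-Reasoning
  rearrange : ∀ a r j → a + (r + j * 2) ≡ (a + j * 2) + r
  rearrange = solve-∀
  k+p+k≤r+[k+j]*2 : k + p + k ≤ n % 2 + (k + j) * 2
  k+p+k≤r+[k+j]*2 = ≤-trans k+p+k≤n (≤-reflexive
    (trans (n≡n%2+n/2*2 n) (cong (λ K → n % 2 + K * 2) (sym k+j≡n/2))))

pow-bound : 2 * m ≤ 2 ^ k → k + p + k ≤ n → m ≤ 2 ^ (n / 2 ∸ 1)
pow-bound {m} {k} {p} 2m≤2^k k+p+k≤n =
  ≤-trans (half-≤-pow {k = k} 2m≤2^k) (^-monoʳ-≤ 2 (∸-monoˡ-≤ 1 (k≤n/2 {k} {p} k+p+k≤n)))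

lemma6p2 : (n : ℕ) → 2 ≤ n →
    ((S : List (F2^ n)) → ThreeTwoOrthogonal dot S →
       (v : F2^ n) → v ∈ S → length (Sᵥ dot S v) ≤ dotBound n)
    ×
    (n % 2 ≡ 0 → (S : List (F2^ n)) → ThreeTwoOrthogonal hyp S →
       (v : F2^ n) → v ∈ S → length (Sᵥ hyp S v) ≤ 2 ^ (n / 2 ∸ 1))
lemma6p2 n _ = dot-bound , hyp-bound
  where
  dot-bound : (S : List (F2^ n)) → ThreeTwoOrthogonal dot S →
    (v : F2^ n) → v ∈ S → length (Sᵥ dot S v) ≤ dotBound n
  dot-bound S S-orth v v∈S =
    let open SᵥSplit dot-form S-orth v∈S
        k , 2∣E∣≤2^k , k+∣O∣+k≤n = dimension-bound
    in subst (_≤ dotBound n) (sym length-T)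
         (dotBound-bound {length E} {k} {length O} 2∣E∣≤2^k k+∣O∣+k≤n)

  hyp-bound : n % 2 ≡ 0 → (S : List (F2^ n)) → ThreeTwoOrthogonal hyp S →
    (v : F2^ n) → v ∈ S → length (Sᵥ hyp S v) ≤ 2 ^ (n / 2 ∸ 1)
  hyp-bound even S S-orth v v∈S =
    let open SᵥSplit (hyp-form even) S-orth v∈S
        k , 2∣E∣≤2^k , k+∣O∣+k≤n = dimension-bound
    in subst (_≤ 2 ^ (n / 2 ∸ 1)) (sym (alternating⇒length-T≡length-E (hyp-alternating even)))
         (pow-bound {length E} {k} {length O} 2∣E∣≤2^k k+∣O∣+k≤n)
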